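{- Let $p\neq 0$, $q$ be integers and $n\ge 0$ an integer. Then \[ \sum_{j = 0}^n P_{q - pj} Q_{p(n - 2j)} = \frac{\begin{vmatrix} P_{pn + 3p + q} - P_{q - 2pn} & P_{3p - 3} & P_{3p - 4} \\ P_{pn + 3p + q + 1} - P_{q - 2pn + 1} & P_{3p - 2} - 1 & P_{3p - 3} \\ P_{pn + 3p + q - 1} - P_{q - 2pn - 1} & P_{3p - 4} & P_{3p - 5} - 1 \end{vmatrix}}{\begin{vmatrix} P_{3p - 2} - 1 & P_{3p - 3} & P_{3p - 4} \\ P_{3p - 1} & P_{3p - 2} - 1 & P_{3p - 3} \\ P_{3p - 3} & P_{3p - 4} & P_{3p - 5} - 1 \end{vmatrix}} +\frac{2\begin{vmatrix} P_{q + 1} P_{pn + p - 4} - P_q P_{pn + p - 3} & P_{p - 4} & 0 \\ P_{q + 2} P_{pn + p - 4} - P_{q + 1} P_{pn + p - 3} & - P_{p - 3} & P_{p - 4} \\ P_q P_{pn + p - 4} - P_{q - 1} P_{pn + p - 3} & 0 & - P_{p - 3} \end{vmatrix}}{\begin{vmatrix} - P_{p - 3} & P_{p - 4} & 0 \\ P_{p - 4} & - P_{p - 3} & P_{p - 4} \\ P_{p - 4} & 0 & - P_{p - 3} \end{vmatrix}}. \] In particular, $\sum_{j=0}^n P_{q-j}Q_{n-2j}=P_{n+q+2}-P_{q-2n-1}-2(P_{q+1}P_{n-3}-P_qP_{n-2})$.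
   Context: The Padovan numbers $P_n$ are defined for all integers $n$ by $P_0=P_1=P_2=1$ and $P_n=P_{n-2}+P_{n-3}$ for all integers $n$ (extended to negative indices via $P_n=P_{n+3}-P_{n+1}$). The Perrin numbers $Q_n$ are defined for all integers $n$ by $Q_0=3$, $Q_1=0$, $Q_2=2$ and $Q_n=Q_{n-2}+Q_{n-3}$ for all integers $n$. -}

module Defs where

open import Data.Nat using (ℕ; zero; suc)
open import Data.Integer using (ℤ; +_; -[1+_]; _+_; _-_; _*_; -_)

padovanℕ : ℕ → ℤ
padovanℕ 0 = + 1
padovanℕ 1 = + 1
padovanℕ 2 = + 1
padovanℕ (suc (suc (suc k))) = padovanℕ (suc k) + padovanℕ k

-- Padovan numbers at nonpositive indices: padovanNeg k = P_{-k}.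
-- From P_n = P_{n+3} - P_{n+1}: P_{-1} = 0, P_{-2} = 1, P_{-(k+3)} = P_{-k} - P_{-(k+2)}
padovanNeg : ℕ → ℤ
padovanNeg 0 = + 1
padovanNeg 1 = + 0
padovanNeg 2 = + 1
padovanNeg (suc (suc (suc k))) = padovanNeg k - padovanNeg (suc (suc k))

P : ℤ → ℤ
P (+ n) = padovanℕ n
P -[1+ n ] = padovanNeg (suc n)

perrinℕ : ℕ → ℤ
perrinℕ 0 = + 3
perrinℕ 1 = + 0
perrinℕ 2 = + 2
perrinℕ (suc (suc (suc k))) = perrinℕ (suc k) + perrinℕ k

-- perrinNeg k = Q_{-k}; Q_{-1} = Q_2 - Q_0 = -1, Q_{-2} = Q_1 - Q_{-1} = 1
perrinNeg : ℕ → ℤ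
perrinNeg 0 = + 3
perrinNeg 1 = - (+ 1)
perrinNeg 2 = + 1
perrinNeg (suc (suc (suc k))) = perrinNeg k - perrinNeg (suc (suc k))

Q : ℤ → ℤ
Q (+ n) = perrinℕ n
Q -[1+ n ] = perrinNeg (suc n)

sumTo : ℕ → (ℕ → ℤ) → ℤ
sumTo zero f = f zero
sumTo (suc n) f = sumTo n f + f (suc n)

det3 : ℤ → ℤ → ℤ → ℤ → ℤ → ℤ → ℤ → ℤ → ℤ → ℤ
det3 a b c d e f g h i =
  a * (e * i - f * h) - b * (d * i - f * g) + c * (d * h - e * g)

module Submission where

-- Let ξ be a root of t³ = t + 1 and work in the ring ℤ[ξ] ≅ ℤ³ (basis 1, ξ, ξ²).
-- Its powers are ξᵏ = P_{k-5} + P_{k-3} ξ + P_{k-4} ξ², so P_k is the coordinate sum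
-- σ(ξᵏ) and Q_k is the trace of ξᵏ; ξ is a unit of norm 1, so ξ⁻ᵏ is the adjugate
-- of ξᵏ.  Every Padovan/Perrin identity needed is thus a polynomial identity in ℤ[ξ].
--
-- Write P_a Q_b = P_{a+b} + Δ(a,b).  With τ_j = (q - pj) + p(n - 2j) the sum splits as
--   S = X + C,   X = Σ_j P_{τ_j},   C = Σ_j Δ(q - pj, p(n - 2j)).
-- * Diagonal part: τ_{j+1} = τ_j - 3p, so multiplication by ξ^{3p} - 1 telescopes along
--   the sum; its three rows form a linear system for Σ P_{τ_j}, Σ P_{τ_j+1}, Σ P_{τ_j-1}
--   with matrix that of D₁, and Cramer's rule gives X·D₁ = N₁.
-- * Cross part: Δ is the increment of a Casoratian W of P, so C telescopes as well;
--   the reflection W(a - c, -c) = -W(a, c) and the recurrence of Δ give a second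
--   system with matrix that of D₂, and Cramer's rule gives C·D₂ = 2N₂.
-- * Denominators: D₁ = N(ξ^{3p} - 1) and D₂ = -N(P_{p-3} - P_{p-4} ξ).  The norm form is
--   anisotropic over ℤ (descent modulo 2), and ξᵏ is an integer only for k = 0.
-- * The case p = 1, where D₁ = 1 and D₂ = -1, is the "in particular" formula.

open import Defs
open import Data.Nat as ℕ using (ℕ; zero; suc; z≤n; s≤s)
open import Data.Nat.Tactic.RingSolver using () renaming (solve-∀ to ℕ-solve-∀)
open import Data.Integer using (ℤ; +_; -[1+_]; _+_; _-_; _*_; -_; ∣_∣; _%ℕ_; _/ℕ_)
open import Data.Integer.DivMod using (a≡a%ℕn+[a/ℕn]*n; n%ℕd<d)
open import Data.Integer.Divisibility.Signed using (_∣_; divides; ∣⇒∣ᵤ; ∣m∣n⇒∣m+n; ∣m∣n⇒∣m-n; ∣m⇒∣-m; ∣n⇒∣m*n; ∣m⇒∣m*n)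
open import Data.Nat.Divisibility using () renaming (_∣?_ to _∣ℕ?_)
open import Data.Product using (_×_; _,_; proj₁; proj₂; Σ)
open import Data.Sum using (inj₁; inj₂)
open import Data.Empty using (⊥-elim)
open import Relation.Nullary using (¬_)
open import Relation.Nullary.Decidable using (False; toWitnessFalse)
open import Relation.Binary.PropositionalEquality using (_≡_; _≢_; refl; sym; trans; cong; cong₂; subst; module ≡-Reasoning)
import Data.Integer.Properties as ℤP
import Data.Nat.Properties as ℕP
open import Data.Integer.Tactic.RingSolver using (solve-∀; ring)
import Tactic.RingSolver.NonReflective ring as NR
open NR using (_⊜_; Κ; _⊕_; ⊝_) renaming (_⊗_ to _⊛_)

-- The cubic ring ℤ[ξ], ξ³ = ξ + 1.

-- a₀ + a₁ ξ + a₂ ξ², with coordinates in an arbitrary type.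
record Cubic (A : Set) : Set where
  constructor ⟨_,_,_⟩
  field c₀ c₁ c₂ : A
open Cubic

cubic-≡ : ∀ {A : Set} {a₀ a₁ a₂ b₀ b₁ b₂ : A} → a₀ ≡ b₀ → a₁ ≡ b₁ → a₂ ≡ b₂ →
          ⟨ a₀ , a₁ , a₂ ⟩ ≡ ⟨ b₀ , b₁ , b₂ ⟩
cubic-≡ refl refl refl = refl

-- They are
-- used on ℤ itself and on the ring solver's expressions, so that each polynomial
-- identity between them is proved by a single call to the solver.
module CubicOps {A : Set} (plus times : A → A → A) (neg : A → A) (lit : ℤ → A) where
  infixl 6 _⊞_ _⊟_
  infixl 7 _⊠_ _·_
  infix 8 ⊟_

  _⊞_ _⊠_ _⊟_ : A → A → A
  _⊞_ = plus
  _⊠_ = times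
  a ⊟ b = a ⊞ neg b

  ⊟_ : A → A
  ⊟_ = neg

  -- multiplication, reducing with ξ³ = ξ + 1 and ξ⁴ = ξ² + ξ
  _·_ : Cubic A → Cubic A → Cubic A
  ⟨ a₀ , a₁ , a₂ ⟩ · ⟨ b₀ , b₁ , b₂ ⟩ =
    ⟨ a₀ ⊠ b₀ ⊞ (a₁ ⊠ b₂ ⊞ a₂ ⊠ b₁)
    , a₀ ⊠ b₁ ⊞ a₁ ⊠ b₀ ⊞ (a₁ ⊠ b₂ ⊞ a₂ ⊠ b₁) ⊞ a₂ ⊠ b₂
    , a₀ ⊠ b₂ ⊞ a₁ ⊠ b₁ ⊞ a₂ ⊠ b₀ ⊞ a₂ ⊠ b₂ ⟩

  scalar : A → Cubic A
  scalar c = ⟨ c , lit (+ 0) , lit (+ 0) ⟩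

  𝟙 ξ ξ² ξ⁻¹ ξ⁻² ξ⁻³ ξ⁻⁴ ξ⁻⁵ : Cubic A
  𝟙   = scalar (lit (+ 1))
  ξ   = ⟨ lit (+ 0) , lit (+ 1) , lit (+ 0) ⟩
  ξ²  = ⟨ lit (+ 0) , lit (+ 0) , lit (+ 1) ⟩
  ξ⁻¹ = ⟨ lit (- + 1) , lit (+ 0) , lit (+ 1) ⟩
  ξ⁻² = ⟨ lit (+ 1) , lit (+ 1) , lit (- + 1) ⟩
  ξ⁻³ = ⟨ lit (+ 0) , lit (- + 1) , lit (+ 1) ⟩
  ξ⁻⁴ = ⟨ lit (- + 1) , lit (+ 1) , lit (+ 0) ⟩
  ξ⁻⁵ = ⟨ lit (+ 2) , lit (+ 0) , lit (- + 1) ⟩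

  -- σ(ξᵏ) = P_k
  σ : Cubic A → A
  σ ⟨ a₀ , a₁ , a₂ ⟩ = a₀ ⊞ a₁ ⊞ a₂

  -- the trace: tr(ξᵏ) = Q_k
  tr : Cubic A → A
  tr ⟨ a₀ , a₁ , a₂ ⟩ = lit (+ 3) ⊠ a₀ ⊞ lit (+ 2) ⊠ a₂

  det : A → A → A → A → A → A → A → A → A → A
  det a b c d e f g h i = a ⊠ (e ⊠ i ⊟ f ⊠ h) ⊟ b ⊠ (d ⊠ i ⊟ f ⊠ g) ⊞ c ⊠ (d ⊠ h ⊟ e ⊠ g)

  -- the norm: determinant of multiplication by u, with columns u, uξ, uξ²
  N : Cubic A → A
  N u = det (c₀ u) (c₀ (u · ξ)) (c₀ (u · ξ²))
            (c₁ u) (c₁ (u · ξ)) (c₁ (u · ξ²))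
            (c₂ u) (c₂ (u · ξ)) (c₂ (u · ξ²))

  -- the adjugate: u · adj u = N u
  adj : Cubic A → Cubic A
  adj u = ⟨ c₁ (u · ξ) ⊠ c₂ (u · ξ²) ⊟ c₁ (u · ξ²) ⊠ c₂ (u · ξ)
          , ⊟ (c₁ u ⊠ c₂ (u · ξ²) ⊟ c₁ (u · ξ²) ⊠ c₂ u)
          , c₁ u ⊠ c₂ (u · ξ) ⊟ c₁ (u · ξ) ⊠ c₂ u ⟩

  -- ω(ξᵃ, ξᶜ) = P_{a+1} P_{c-4} - P_a P_{c-3}, a Casoratian of the Padovan sequence
  ω : Cubic A → Cubic A → A
  ω a b = σ (a · ξ) ⊠ σ (b · ξ⁻⁴) ⊟ σ a ⊠ σ (b · ξ⁻³)

  -- φ(ξᵃ, ξᵇ) = P_a Q_b - P_{a+b}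
  φ : Cubic A → Cubic A → A
  φ a b = σ a ⊠ tr b ⊟ σ (a · b)

module Syn {n : ℕ} = CubicOps {NR.Expr ℤ n} _⊕_ _⊛_ ⊝_ Κ
open CubicOps {ℤ} _+_ _*_ -_ (λ z → z)
  using (_·_; scalar; 𝟙; ξ; ξ²; ξ⁻¹; ξ⁻²; ξ⁻³; ξ⁻⁴; ξ⁻⁵; σ; tr; det; N; adj; ω; φ)

·-assoc : ∀ u v w → (u · v) · w ≡ u · (v · w)
·-assoc ⟨ a₀ , a₁ , a₂ ⟩ ⟨ b₀ , b₁ , b₂ ⟩ ⟨ d₀ , d₁ , d₂ ⟩ = cubic-≡
  (NR.solve 9 (λ a₀ a₁ a₂ b₀ b₁ b₂ d₀ d₁ d₂ → c₀ (Syn._·_ (Syn._·_ ⟨ a₀ , a₁ , a₂ ⟩ ⟨ b₀ , b₁ , b₂ ⟩) ⟨ d₀ , d₁ , d₂ ⟩) ⊜ c₀ (Syn._·_ ⟨ a₀ , a₁ , a₂ ⟩ (Syn._·_ ⟨ b₀ , b₁ , b₂ ⟩ ⟨ d₀ , d₁ , d₂ ⟩))) refl a₀ a₁ a₂ b₀ b₁ b₂ d₀ d₁ d₂)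
  (NR.solve 9 (λ a₀ a₁ a₂ b₀ b₁ b₂ d₀ d₁ d₂ → c₁ (Syn._·_ (Syn._·_ ⟨ a₀ , a₁ , a₂ ⟩ ⟨ b₀ , b₁ , b₂ ⟩) ⟨ d₀ , d₁ , d₂ ⟩) ⊜ c₁ (Syn._·_ ⟨ a₀ , a₁ , a₂ ⟩ (Syn._·_ ⟨ b₀ , b₁ , b₂ ⟩ ⟨ d₀ , d₁ , d₂ ⟩))) refl a₀ a₁ a₂ b₀ b₁ b₂ d₀ d₁ d₂)
  (NR.solve 9 (λ a₀ a₁ a₂ b₀ b₁ b₂ d₀ d₁ d₂ → c₂ (Syn._·_ (Syn._·_ ⟨ a₀ , a₁ , a₂ ⟩ ⟨ b₀ , b₁ , b₂ ⟩) ⟨ d₀ , d₁ , d₂ ⟩) ⊜ c₂ (Syn._·_ ⟨ a₀ , a₁ , a₂ ⟩ (Syn._·_ ⟨ b₀ , b₁ , b₂ ⟩ ⟨ d₀ , d₁ , d₂ ⟩))) refl a₀ a₁ a₂ b₀ b₁ b₂ d₀ d₁ d₂)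

·-identityʳ : ∀ u → u · 𝟙 ≡ u
·-identityʳ ⟨ a₀ , a₁ , a₂ ⟩ = cubic-≡
  (NR.solve 3 (λ a₀ a₁ a₂ → c₀ (Syn._·_ ⟨ a₀ , a₁ , a₂ ⟩ Syn.𝟙) ⊜ a₀) refl a₀ a₁ a₂)
  (NR.solve 3 (λ a₀ a₁ a₂ → c₁ (Syn._·_ ⟨ a₀ , a₁ , a₂ ⟩ Syn.𝟙) ⊜ a₁) refl a₀ a₁ a₂)
  (NR.solve 3 (λ a₀ a₁ a₂ → c₂ (Syn._·_ ⟨ a₀ , a₁ , a₂ ⟩ Syn.𝟙) ⊜ a₂) refl a₀ a₁ a₂)

·-identityˡ : ∀ u → 𝟙 · u ≡ u
·-identityˡ ⟨ a₀ , a₁ , a₂ ⟩ = cubic-≡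
  (NR.solve 3 (λ a₀ a₁ a₂ → c₀ (Syn._·_ Syn.𝟙 ⟨ a₀ , a₁ , a₂ ⟩) ⊜ a₀) refl a₀ a₁ a₂)
  (NR.solve 3 (λ a₀ a₁ a₂ → c₁ (Syn._·_ Syn.𝟙 ⟨ a₀ , a₁ , a₂ ⟩) ⊜ a₁) refl a₀ a₁ a₂)
  (NR.solve 3 (λ a₀ a₁ a₂ → c₂ (Syn._·_ Syn.𝟙 ⟨ a₀ , a₁ , a₂ ⟩) ⊜ a₂) refl a₀ a₁ a₂)

scalar-· : ∀ c u → scalar c · u ≡ ⟨ c * c₀ u , c * c₁ u , c * c₂ u ⟩
scalar-· c ⟨ a₀ , a₁ , a₂ ⟩ = cubic-≡
  (NR.solve 4 (λ c a₀ a₁ a₂ → c₀ (Syn._·_ (Syn.scalar c) ⟨ a₀ , a₁ , a₂ ⟩) ⊜ c ⊛ a₀) refl c a₀ a₁ a₂)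
  (NR.solve 4 (λ c a₀ a₁ a₂ → c₁ (Syn._·_ (Syn.scalar c) ⟨ a₀ , a₁ , a₂ ⟩) ⊜ c ⊛ a₁) refl c a₀ a₁ a₂)
  (NR.solve 4 (λ c a₀ a₁ a₂ → c₂ (Syn._·_ (Syn.scalar c) ⟨ a₀ , a₁ , a₂ ⟩) ⊜ c ⊛ a₂) refl c a₀ a₁ a₂)

·ξ : ∀ a₀ a₁ a₂ → ⟨ a₀ , a₁ , a₂ ⟩ · ξ ≡ ⟨ a₂ , a₀ + a₂ , a₁ ⟩
·ξ a₀ a₁ a₂ = cubic-≡
  (NR.solve 3 (λ a₀ a₁ a₂ → c₀ (Syn._·_ ⟨ a₀ , a₁ , a₂ ⟩ Syn.ξ) ⊜ a₂) refl a₀ a₁ a₂)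
  (NR.solve 3 (λ a₀ a₁ a₂ → c₁ (Syn._·_ ⟨ a₀ , a₁ , a₂ ⟩ Syn.ξ) ⊜ (a₀ ⊕ a₂)) refl a₀ a₁ a₂)
  (NR.solve 3 (λ a₀ a₁ a₂ → c₂ (Syn._·_ ⟨ a₀ , a₁ , a₂ ⟩ Syn.ξ) ⊜ a₁) refl a₀ a₁ a₂)

·ξ·ξ⁻¹ : ∀ u → (u · ξ) · ξ⁻¹ ≡ u
·ξ·ξ⁻¹ ⟨ a₀ , a₁ , a₂ ⟩ = cubic-≡
  (NR.solve 3 (λ a₀ a₁ a₂ → c₀ (Syn._·_ (Syn._·_ ⟨ a₀ , a₁ , a₂ ⟩ Syn.ξ) Syn.ξ⁻¹) ⊜ a₀) refl a₀ a₁ a₂)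
  (NR.solve 3 (λ a₀ a₁ a₂ → c₁ (Syn._·_ (Syn._·_ ⟨ a₀ , a₁ , a₂ ⟩ Syn.ξ) Syn.ξ⁻¹) ⊜ a₁) refl a₀ a₁ a₂)
  (NR.solve 3 (λ a₀ a₁ a₂ → c₂ (Syn._·_ (Syn._·_ ⟨ a₀ , a₁ , a₂ ⟩ Syn.ξ) Syn.ξ⁻¹) ⊜ a₂) refl a₀ a₁ a₂)

-- ξ has norm 1
N-·ξ : ∀ u → N (u · ξ) ≡ N u
N-·ξ ⟨ a₀ , a₁ , a₂ ⟩ = NR.solve 3 (λ a₀ a₁ a₂ → Syn.N (Syn._·_ ⟨ a₀ , a₁ , a₂ ⟩ Syn.ξ) ⊜ Syn.N ⟨ a₀ , a₁ , a₂ ⟩) refl a₀ a₁ a₂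

·-adj : ∀ u → u · adj u ≡ scalar (N u)
·-adj ⟨ a₀ , a₁ , a₂ ⟩ = cubic-≡
  (NR.solve 3 (λ a₀ a₁ a₂ → c₀ (Syn._·_ ⟨ a₀ , a₁ , a₂ ⟩ (Syn.adj ⟨ a₀ , a₁ , a₂ ⟩)) ⊜ Syn.N ⟨ a₀ , a₁ , a₂ ⟩) refl a₀ a₁ a₂)
  (NR.solve 3 (λ a₀ a₁ a₂ → c₁ (Syn._·_ ⟨ a₀ , a₁ , a₂ ⟩ (Syn.adj ⟨ a₀ , a₁ , a₂ ⟩)) ⊜ Κ (+ 0)) refl a₀ a₁ a₂)
  (NR.solve 3 (λ a₀ a₁ a₂ → c₂ (Syn._·_ ⟨ a₀ , a₁ , a₂ ⟩ (Syn.adj ⟨ a₀ , a₁ , a₂ ⟩)) ⊜ Κ (+ 0)) refl a₀ a₁ a₂)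

Recurrent : (ℤ → ℤ) → Set
Recurrent f = ∀ k → f (k + + 3) ≡ f (k + + 1) + f k

-- a = b + (a - b); at a negative index this turns the defining clause
-- f(k) = f(k+3) - f(k+1) into the recurrence
split-off : ∀ a b → a ≡ b + (a - b)
split-off = solve-∀

P-recurrent : Recurrent P
P-recurrent (+ n) rewrite ℕP.+-comm n 3 | ℕP.+-comm n 1 = refl
P-recurrent -[1+ 0 ] = refl
P-recurrent -[1+ 1 ] = refl
P-recurrent -[1+ 2 ] = refl
P-recurrent -[1+ suc (suc (suc m)) ] = split-off (padovanNeg (suc m)) (padovanNeg (suc (suc (suc m))))

Q-recurrent : Recurrent Q
Q-recurrent (+ n) rewrite ℕP.+-comm n 3 | ℕP.+-comm n 1 = refl
Q-recurrent -[1+ 0 ] = refl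
Q-recurrent -[1+ 1 ] = refl
Q-recurrent -[1+ 2 ] = refl
Q-recurrent -[1+ suc (suc (suc m)) ] = split-off (perrinNeg (suc m)) (perrinNeg (suc (suc (suc m))))

P-rec : ∀ k → P k ≡ P (k - + 2) + P (k - + 3)
P-rec k = trans (cong P (sym (back k))) (trans (P-recurrent (k - + 3)) (cong (λ i → P i + P (k - + 3)) (back₁ k)))
  where
  back : ∀ k → k - + 3 + + 3 ≡ k
  back = solve-∀
  back₁ : ∀ k → k - + 3 + + 1 ≡ k - + 2
  back₁ = solve-∀

P-rec₂ : ∀ k → P (k - + 2) ≡ P (k - + 4) + P (k - + 5)
P-rec₂ k = trans (P-rec (k - + 2)) (cong₂ (λ i j → P i + P j) (idx₄ k) (idx₅ k))
  where
  idx₄ : ∀ k → k - + 2 - + 2 ≡ k - + 4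
  idx₄ = solve-∀
  idx₅ : ∀ k → k - + 2 - + 3 ≡ k - + 5
  idx₅ = solve-∀

subtract : ∀ {z y x} → z ≡ y + x → x ≡ z - y
subtract {y = y} {x} refl = cancel y x
  where
  cancel : ∀ y x → x ≡ y + x - y
  cancel = solve-∀

pred-suc : ∀ k → k - + 1 + + 1 ≡ k
pred-suc = solve-∀

ℤ-induction : (Pr : ℤ → Set) → Pr (+ 0) → (∀ k → Pr k → Pr (k + + 1)) → (∀ k → Pr k → Pr (k - + 1)) → ∀ k → Pr k
ℤ-induction Pr base up down (+ zero) = base
ℤ-induction Pr base up down (+ suc n) =
  subst Pr (cong +_ (ℕP.+-comm n 1)) (up (+ n) (ℤ-induction Pr base up down (+ n)))
ℤ-induction Pr base up down -[1+ zero ] = down (+ 0) base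
ℤ-induction Pr base up down -[1+ suc n ] =
  subst Pr (cong (λ m → -[1+ suc m ]) (ℕP.+-identityʳ n)) (down -[1+ n ] (ℤ-induction Pr base up down -[1+ n ]))

recurrent-unique : ∀ f g → Recurrent f → Recurrent g →
                   f (+ 0) ≡ g (+ 0) → f (+ 1) ≡ g (+ 1) → f (+ 2) ≡ g (+ 2) → ∀ k → f k ≡ g k
recurrent-unique f g rf rg e₀ e₁ e₂ k = proj₁ (ℤ-induction Agree (e₀ , e₁ , e₂) up down k)
  where
  Agree : ℤ → Set
  Agree k = f k ≡ g k × f (k + + 1) ≡ g (k + + 1) × f (k + + 2) ≡ g (k + + 2)
  at : ∀ {i j} → i ≡ j → f i ≡ g i → f j ≡ g j
  at i≡j = subst (λ i → f i ≡ g i) i≡j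
  up₁ : ∀ k → k + + 1 + + 1 ≡ k + + 2
  up₁ = solve-∀
  up₂ : ∀ k → k + + 1 + + 2 ≡ k + + 3
  up₂ = solve-∀
  down₂ : ∀ k → k - + 1 + + 2 ≡ k + + 1
  down₂ = solve-∀
  down₃ : ∀ k → k - + 1 + + 3 ≡ k + + 2
  down₃ = solve-∀
  up : ∀ k → Agree k → Agree (k + + 1)
  up k (a , b , c) = b , at (sym (up₁ k)) c
                   , at (sym (up₂ k)) (trans (rf k) (trans (cong₂ _+_ b a) (sym (rg k))))
  down : ∀ k → Agree k → Agree (k - + 1)
  down k (a , b , c) = previous , at (sym (pred-suc k)) a , at (sym (down₂ k)) b
    where
    previous : f (k - + 1) ≡ g (k - + 1)
    previous = trans (subtract (rf (k - + 1)))
               (trans (cong₂ _-_ (at (sym (down₃ k)) c) (at (sym (pred-suc k)) a)) (sym (subtract (rg (k - + 1)))))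

recurrent-shift : ∀ c → Recurrent (λ k → P (k + c))
recurrent-shift c k = trans (cong P (idx₃ k c)) (trans (P-recurrent (k + c)) (cong (_+ P (k + c)) (cong P (sym (idx₁ k c)))))
  where
  idx₃ : ∀ k c → k + + 3 + c ≡ k + c + + 3
  idx₃ = solve-∀
  idx₁ : ∀ k c → k + + 1 + c ≡ k + c + + 1
  idx₁ = solve-∀

recurrent-lin : ∀ {f g} → Recurrent f → Recurrent g → ∀ a b → Recurrent (λ k → a * f k + b * g k)
recurrent-lin {f} {g} rf rg a b k =
  trans (cong₂ _+_ (cong (a *_) (rf k)) (cong (b *_) (rg k))) (regroup a b (f (k + + 1)) (f k) (g (k + + 1)) (g k))
  where
  regroup : ∀ a b x y u v → a * (x + y) + b * (u + v) ≡ a * x + b * u + (a * y + b * v)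
  regroup = solve-∀

infix 9 ξ^_

ξ^_ : ℤ → Cubic ℤ
ξ^ k = ⟨ P (k - + 5) , P (k - + 3) , P (k - + 4) ⟩

P-σ : ∀ k → P k ≡ σ (ξ^ k)
P-σ k = trans (P-rec k) (trans (cong (_+ P (k - + 3)) (P-rec₂ k)) (regroup (P (k - + 3)) (P (k - + 4)) (P (k - + 5))))
  where
  regroup : ∀ x y z → y + z + x ≡ z + x + y
  regroup = solve-∀

-- Q is the recurrent sequence 3P_{k-5} + 2P_{k-4}, i.e. the trace of ξᵏ
Q-tr : ∀ k → Q k ≡ tr (ξ^ k)
Q-tr = recurrent-unique Q (λ k → + 3 * P (k - + 5) + + 2 * P (k - + 4)) Q-recurrent
         (recurrent-lin {λ k → P (k - + 5)} {λ k → P (k - + 4)} (recurrent-shift (- + 5)) (recurrent-shift (- + 4)) (+ 3) (+ 2))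
         refl refl refl

ξ^-suc : ∀ k → ξ^ (k + + 1) ≡ ξ^ k · ξ
ξ^-suc k = trans (cubic-≡ (cong P (idx₄ k)) (trans (cong P (idx₂ k)) (trans (P-rec₂ k) (ℤP.+-comm (P (k - + 4)) (P (k - + 5)))))
                          (cong P (idx₃ k)))
                 (sym (·ξ (P (k - + 5)) (P (k - + 3)) (P (k - + 4))))
  where
  idx₄ : ∀ k → k + + 1 - + 5 ≡ k - + 4
  idx₄ = solve-∀
  idx₂ : ∀ k → k + + 1 - + 3 ≡ k - + 2
  idx₂ = solve-∀
  idx₃ : ∀ k → k + + 1 - + 4 ≡ k - + 3
  idx₃ = solve-∀

ξ^-pred : ∀ k → ξ^ (k - + 1) ≡ ξ^ k · ξ⁻¹
ξ^-pred k = trans (sym (·ξ·ξ⁻¹ (ξ^ (k - + 1))))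
                  (cong (_· ξ⁻¹) (trans (sym (ξ^-suc (k - + 1))) (cong ξ^_ (pred-suc k))))

ξ^-+ : ∀ a b → ξ^ (a + b) ≡ ξ^ a · ξ^ b
ξ^-+ a = ℤ-induction (λ b → ξ^ (a + b) ≡ ξ^ a · ξ^ b) base up down
  where
  base : ξ^ (a + + 0) ≡ ξ^ a · 𝟙
  base = trans (cong ξ^_ (ℤP.+-identityʳ a)) (sym (·-identityʳ (ξ^ a)))
  assoc₁ : ∀ a b → a + (b + + 1) ≡ a + b + + 1
  assoc₁ = solve-∀
  assoc₋₁ : ∀ a b → a + (b - + 1) ≡ a + b - + 1
  assoc₋₁ = solve-∀
  up : ∀ b → ξ^ (a + b) ≡ ξ^ a · ξ^ b → ξ^ (a + (b + + 1)) ≡ ξ^ a · ξ^ (b + + 1)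
  up b ih = begin
    ξ^ (a + (b + + 1))   ≡⟨ cong ξ^_ (assoc₁ a b) ⟩
    ξ^ (a + b + + 1)     ≡⟨ ξ^-suc (a + b) ⟩
    ξ^ (a + b) · ξ       ≡⟨ cong (_· ξ) ih ⟩
    (ξ^ a · ξ^ b) · ξ    ≡⟨ ·-assoc (ξ^ a) (ξ^ b) ξ ⟩
    ξ^ a · (ξ^ b · ξ)    ≡⟨ cong (ξ^ a ·_) (sym (ξ^-suc b)) ⟩
    ξ^ a · ξ^ (b + + 1)  ∎
    where open ≡-Reasoning
  down : ∀ b → ξ^ (a + b) ≡ ξ^ a · ξ^ b → ξ^ (a + (b - + 1)) ≡ ξ^ a · ξ^ (b - + 1)
  down b ih = begin
    ξ^ (a + (b - + 1))   ≡⟨ cong ξ^_ (assoc₋₁ a b) ⟩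
    ξ^ (a + b - + 1)     ≡⟨ ξ^-pred (a + b) ⟩
    ξ^ (a + b) · ξ⁻¹     ≡⟨ cong (_· ξ⁻¹) ih ⟩
    (ξ^ a · ξ^ b) · ξ⁻¹  ≡⟨ ·-assoc (ξ^ a) (ξ^ b) ξ⁻¹ ⟩
    ξ^ a · (ξ^ b · ξ⁻¹)  ≡⟨ cong (ξ^ a ·_) (sym (ξ^-pred b)) ⟩
    ξ^ a · ξ^ (b - + 1)  ∎
    where open ≡-Reasoning

P-σ· : ∀ i j → P (i + j) ≡ σ (ξ^ i · ξ^ j)
P-σ· i j = trans (P-σ (i + j)) (cong σ (ξ^-+ i j))

N-ξ^ : ∀ k → N (ξ^ k) ≡ + 1
N-ξ^ = ℤ-induction (λ k → N (ξ^ k) ≡ + 1) refl up down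
  where
  up : ∀ k → N (ξ^ k) ≡ + 1 → N (ξ^ (k + + 1)) ≡ + 1
  up k ih = trans (cong N (ξ^-suc k)) (trans (N-·ξ (ξ^ k)) ih)
  down : ∀ k → N (ξ^ k) ≡ + 1 → N (ξ^ (k - + 1)) ≡ + 1
  down k ih = trans (sym (N-·ξ (ξ^ (k - + 1))))
                    (trans (cong N (sym (ξ^-suc (k - + 1)))) (trans (cong (λ i → N (ξ^ i)) (pred-suc k)) ih))

-- ξ is a unit of norm 1, so ξ⁻ᶜ is the adjugate of ξᶜ
ξ^-neg : ∀ c → ξ^ (- c) ≡ adj (ξ^ c)
ξ^-neg c = begin
    ξ^ (- c)                            ≡⟨ sym (·-identityʳ (ξ^ (- c))) ⟩
    ξ^ (- c) · scalar (+ 1)             ≡⟨ cong (λ z → ξ^ (- c) · scalar z) (sym (N-ξ^ c)) ⟩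
    ξ^ (- c) · scalar (N (ξ^ c))        ≡⟨ cong (ξ^ (- c) ·_) (sym (·-adj (ξ^ c))) ⟩
    ξ^ (- c) · (ξ^ c · adj (ξ^ c))      ≡⟨ sym (·-assoc (ξ^ (- c)) (ξ^ c) (adj (ξ^ c))) ⟩
    (ξ^ (- c) · ξ^ c) · adj (ξ^ c)      ≡⟨ cong (_· adj (ξ^ c)) (sym (ξ^-+ (- c) c)) ⟩
    ξ^ (- c + c) · adj (ξ^ c)           ≡⟨ cong (λ z → ξ^ z · adj (ξ^ c)) (ℤP.+-inverseˡ c) ⟩
    𝟙 · adj (ξ^ c)                      ≡⟨ ·-identityˡ (adj (ξ^ c)) ⟩
    adj (ξ^ c)                          ∎
  where open ≡-Reasoning

sumTo-cong : ∀ n {f g : ℕ → ℤ} → (∀ j → f j ≡ g j) → sumTo n f ≡ sumTo n g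
sumTo-cong zero    f≡g = f≡g 0
sumTo-cong (suc n) f≡g = cong₂ _+_ (sumTo-cong n f≡g) (f≡g (suc n))

sumTo-+ : ∀ n (f g : ℕ → ℤ) → sumTo n (λ j → f j + g j) ≡ sumTo n f + sumTo n g
sumTo-+ zero    f g = refl
sumTo-+ (suc n) f g = trans (cong (_+ (f (suc n) + g (suc n))) (sumTo-+ n f g))
                            (interchange (sumTo n f) (sumTo n g) (f (suc n)) (g (suc n)))
  where
  interchange : ∀ a b c d → (a + b) + (c + d) ≡ (a + c) + (b + d)
  interchange = solve-∀

sumTo-* : ∀ n c (f : ℕ → ℤ) → sumTo n (λ j → c * f j) ≡ c * sumTo n f
sumTo-* zero    c f = refl
sumTo-* (suc n) c f = trans (cong (_+ c * f (suc n)) (sumTo-* n c f)) (sym (ℤP.*-distribˡ-+ c (sumTo n f) (f (suc n))))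

sumTo-lin₂ : ∀ n a b (f g : ℕ → ℤ) → sumTo n (λ j → a * f j + b * g j) ≡ a * sumTo n f + b * sumTo n g
sumTo-lin₂ n a b f g = trans (sumTo-+ n (λ j → a * f j) (λ j → b * g j)) (cong₂ _+_ (sumTo-* n a f) (sumTo-* n b g))

sumTo-lin₃ : ∀ n a b c (f g h : ℕ → ℤ) →
             sumTo n (λ j → a * f j + b * g j + c * h j) ≡ a * sumTo n f + b * sumTo n g + c * sumTo n h
sumTo-lin₃ n a b c f g h = trans (sumTo-+ n (λ j → a * f j + b * g j) (λ j → c * h j))
                                 (cong₂ _+_ (sumTo-lin₂ n a b f g) (sumTo-* n c h))

telescope : ∀ n (h : ℕ → ℤ) → sumTo n (λ j → h j - h (suc j)) ≡ h 0 - h (suc n)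
telescope zero    h = refl
telescope (suc n) h = trans (cong (_+ (h (suc n) - h (suc (suc n)))) (telescope n h)) (chain (h 0) (h (suc n)) (h (suc (suc n))))
  where
  chain : ∀ a b c → (a - b) + (b - c) ≡ a - c
  chain = solve-∀

S : ℤ → ℤ → ℕ → ℤ
S p q n = sumTo n (λ j → P (q - p * + j) * Q (p * (+ n - + 2 * + j)))

D₁ : ℤ → ℤ
D₁ p = det3 (P (+ 3 * p - + 2) - + 1) (P (+ 3 * p - + 3)) (P (+ 3 * p - + 4))
            (P (+ 3 * p - + 1)) (P (+ 3 * p - + 2) - + 1) (P (+ 3 * p - + 3))
            (P (+ 3 * p - + 3)) (P (+ 3 * p - + 4)) (P (+ 3 * p - + 5) - + 1)

D₂ : ℤ → ℤ
D₂ p = det3 (- P (p - + 3)) (P (p - + 4)) (+ 0)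
            (P (p - + 4)) (- P (p - + 3)) (P (p - + 4))
            (P (p - + 4)) (+ 0) (- P (p - + 3))

N₁ : ℤ → ℤ → ℕ → ℤ
N₁ p q n = det3 (P (p * + n + + 3 * p + q) - P (q - + 2 * p * + n)) (P (+ 3 * p - + 3)) (P (+ 3 * p - + 4))
                (P (p * + n + + 3 * p + q + + 1) - P (q - + 2 * p * + n + + 1)) (P (+ 3 * p - + 2) - + 1) (P (+ 3 * p - + 3))
                (P (p * + n + + 3 * p + q - + 1) - P (q - + 2 * p * + n - + 1)) (P (+ 3 * p - + 4)) (P (+ 3 * p - + 5) - + 1)

N₂ : ℤ → ℤ → ℕ → ℤ
N₂ p q n = det3 (P (q + + 1) * P (p * + n + p - + 4) - P q * P (p * + n + p - + 3)) (P (p - + 4)) (+ 0)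
                (P (q + + 2) * P (p * + n + p - + 4) - P (q + + 1) * P (p * + n + p - + 3)) (- P (p - + 3)) (P (p - + 4))
                (P q * P (p * + n + p - + 4) - P (q - + 1) * P (p * + n + p - + 3)) (+ 0) (- P (p - + 3))

Δ : ℤ → ℤ → ℤ
Δ a b = P a * Q b - P (a + b)

-- the diagonal index τ_j = (q - pj) + p(n - 2j); note τ_{j+1} = τ_j - 3p
τ : ℤ → ℤ → ℕ → ℕ → ℤ
τ p q n j = (q - p * + j) + p * (+ n - + 2 * + j)

X : ℤ → ℤ → ℕ → ℤ
X p q n = sumTo n (λ j → P (τ p q n j))

X-shift : ℤ → ℤ → ℕ → ℤ → ℤ
X-shift p q n δ = sumTo n (λ j → P (τ p q n j + δ))

C : ℤ → ℕ → ℤ → ℤ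
C p n q = sumTo n (λ j → Δ (q - p * + j) (p * (+ n - + 2 * + j)))

S-split : ∀ p q n → S p q n ≡ X p q n + C p n q
S-split p q n = trans (sumTo-cong n (λ j → split-off (P (q - p * + j) * Q (p * (+ n - + 2 * + j))) (P (τ p q n j))))
                      (sumTo-+ n _ _)

-- The diagonal part: X · D₁ = N₁.

-- Multiplying u by w and subtracting u, read through σ in the coordinates
-- (σ u, σ(uξ), σ(uξ⁻¹)): each row is a linear form whose coefficients come from w.
σ-row₀ : ∀ u w → σ (u · w) - σ u ≡ (σ (w · ξ⁻²) - + 1) * σ u + σ (w · ξ⁻³) * σ (u · ξ) + σ (w · ξ⁻⁴) * σ (u · ξ⁻¹)
σ-row₀ ⟨ u₀ , u₁ , u₂ ⟩ ⟨ w₀ , w₁ , w₂ ⟩ = NR.solve 6 (λ u₀ u₁ u₂ w₀ w₁ w₂ →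
  let u = ⟨ u₀ , u₁ , u₂ ⟩ ; w = ⟨ w₀ , w₁ , w₂ ⟩ in
  Syn._⊟_ (Syn.σ (Syn._·_ u w)) (Syn.σ u)
  ⊜ (Syn._⊟_ (Syn.σ (Syn._·_ w Syn.ξ⁻²)) (Κ (+ 1)) ⊛ Syn.σ u ⊕ Syn.σ (Syn._·_ w Syn.ξ⁻³) ⊛ Syn.σ (Syn._·_ u Syn.ξ)
     ⊕ Syn.σ (Syn._·_ w Syn.ξ⁻⁴) ⊛ Syn.σ (Syn._·_ u Syn.ξ⁻¹))) refl u₀ u₁ u₂ w₀ w₁ w₂

σ-row₁ : ∀ u w → σ ((u · w) · ξ) - σ (u · ξ) ≡ σ (w · ξ⁻¹) * σ u + (σ (w · ξ⁻²) - + 1) * σ (u · ξ) + σ (w · ξ⁻³) * σ (u · ξ⁻¹)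
σ-row₁ ⟨ u₀ , u₁ , u₂ ⟩ ⟨ w₀ , w₁ , w₂ ⟩ = NR.solve 6 (λ u₀ u₁ u₂ w₀ w₁ w₂ →
  let u = ⟨ u₀ , u₁ , u₂ ⟩ ; w = ⟨ w₀ , w₁ , w₂ ⟩ in
  Syn._⊟_ (Syn.σ (Syn._·_ (Syn._·_ u w) Syn.ξ)) (Syn.σ (Syn._·_ u Syn.ξ))
  ⊜ (Syn.σ (Syn._·_ w Syn.ξ⁻¹) ⊛ Syn.σ u ⊕ Syn._⊟_ (Syn.σ (Syn._·_ w Syn.ξ⁻²)) (Κ (+ 1)) ⊛ Syn.σ (Syn._·_ u Syn.ξ)
     ⊕ Syn.σ (Syn._·_ w Syn.ξ⁻³) ⊛ Syn.σ (Syn._·_ u Syn.ξ⁻¹))) refl u₀ u₁ u₂ w₀ w₁ w₂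

σ-row₋₁ : ∀ u w → σ ((u · w) · ξ⁻¹) - σ (u · ξ⁻¹) ≡ σ (w · ξ⁻³) * σ u + σ (w · ξ⁻⁴) * σ (u · ξ) + (σ (w · ξ⁻⁵) - + 1) * σ (u · ξ⁻¹)
σ-row₋₁ ⟨ u₀ , u₁ , u₂ ⟩ ⟨ w₀ , w₁ , w₂ ⟩ = NR.solve 6 (λ u₀ u₁ u₂ w₀ w₁ w₂ →
  let u = ⟨ u₀ , u₁ , u₂ ⟩ ; w = ⟨ w₀ , w₁ , w₂ ⟩ in
  Syn._⊟_ (Syn.σ (Syn._·_ (Syn._·_ u w) Syn.ξ⁻¹)) (Syn.σ (Syn._·_ u Syn.ξ⁻¹))
  ⊜ (Syn.σ (Syn._·_ w Syn.ξ⁻³) ⊛ Syn.σ u ⊕ Syn.σ (Syn._·_ w Syn.ξ⁻⁴) ⊛ Syn.σ (Syn._·_ u Syn.ξ)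
     ⊕ Syn._⊟_ (Syn.σ (Syn._·_ w Syn.ξ⁻⁵)) (Κ (+ 1)) ⊛ Syn.σ (Syn._·_ u Syn.ξ⁻¹))) refl u₀ u₁ u₂ w₀ w₁ w₂

-- The same rows for w = ξᴹ, u = ξᵗ: the increments P_{t+M+δ} - P_{t+δ} (δ = 0, 1, -1)
-- are linear in (P_t, P_{t+1}, P_{t-1}) with the rows of the matrix of D₁ (for M = 3p).
shift-row₀ : ∀ t M → P (t + M) - P t ≡ (P (M - + 2) - + 1) * P t + P (M - + 3) * P (t + + 1) + P (M - + 4) * P (t - + 1)
shift-row₀ t M =
  trans (cong₂ _-_ (P-σ· t M) (P-σ t))
  (trans (σ-row₀ (ξ^ t) (ξ^ M))
  (sym (cong₂ _+_ (cong₂ _+_ (cong₂ _*_ (cong (_- + 1) (P-σ· M (- + 2))) (P-σ t))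
                             (cong₂ _*_ (P-σ· M (- + 3)) (P-σ· t (+ 1))))
                  (cong₂ _*_ (P-σ· M (- + 4)) (P-σ· t (- + 1))))))

shift-row₁ : ∀ t M → P (t + M + + 1) - P (t + + 1) ≡ P (M - + 1) * P t + (P (M - + 2) - + 1) * P (t + + 1) + P (M - + 3) * P (t - + 1)
shift-row₁ t M =
  trans (cong₂ _-_ (trans (P-σ· (t + M) (+ 1)) (cong (λ z → σ (z · ξ)) (ξ^-+ t M))) (P-σ· t (+ 1)))
  (trans (σ-row₁ (ξ^ t) (ξ^ M))
  (sym (cong₂ _+_ (cong₂ _+_ (cong₂ _*_ (P-σ· M (- + 1)) (P-σ t))
                             (cong₂ _*_ (cong (_- + 1) (P-σ· M (- + 2))) (P-σ· t (+ 1))))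
                  (cong₂ _*_ (P-σ· M (- + 3)) (P-σ· t (- + 1))))))

shift-row₋₁ : ∀ t M → P (t + M - + 1) - P (t - + 1) ≡ P (M - + 3) * P t + P (M - + 4) * P (t + + 1) + (P (M - + 5) - + 1) * P (t - + 1)
shift-row₋₁ t M =
  trans (cong₂ _-_ (trans (P-σ· (t + M) (- + 1)) (cong (λ z → σ (z · ξ⁻¹)) (ξ^-+ t M))) (P-σ· t (- + 1)))
  (trans (σ-row₋₁ (ξ^ t) (ξ^ M))
  (sym (cong₂ _+_ (cong₂ _+_ (cong₂ _*_ (P-σ· M (- + 3)) (P-σ t))
                             (cong₂ _*_ (P-σ· M (- + 4)) (P-σ· t (+ 1))))
                  (cong₂ _*_ (cong (_- + 1) (P-σ· M (- + 5))) (P-σ· t (- + 1))))))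

-- since t_{j+1} + 3p = t_j, the increments telescope along the diagonal
diag-telescope : ∀ p q n δ → sumTo n (λ j → P (τ p q n j + + 3 * p + δ) - P (τ p q n j + δ))
                             ≡ P (p * + n + + 3 * p + q + δ) - P (q - + 2 * p * + n + δ)
diag-telescope p q n δ = trans (sumTo-cong n step) (trans (telescope n h) (cong₂ _-_ (cong P (first p q (+ n) δ)) (cong P (last p q (+ n) δ))))
  where
  h : ℕ → ℤ
  h j = P (τ p q n j + + 3 * p + δ)
  next : ∀ p q N J δ → (q - p * J) + p * (N - + 2 * J) + δ ≡ (q - p * (+ 1 + J)) + p * (N - + 2 * (+ 1 + J)) + + 3 * p + δ
  next = solve-∀
  first : ∀ p q N δ → (q - p * + 0) + p * (N - + 2 * + 0) + + 3 * p + δ ≡ p * N + + 3 * p + q + δ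
  first = solve-∀
  last : ∀ p q N δ → (q - p * (+ 1 + N)) + p * (N - + 2 * (+ 1 + N)) + + 3 * p + δ ≡ q - + 2 * p * N + δ
  last = solve-∀
  step : ∀ j → P (τ p q n j + + 3 * p + δ) - P (τ p q n j + δ) ≡ h j - h (suc j)
  step j = cong (λ z → h j - P z) (next p q (+ n) (+ j) δ)

det3-col₁-cong : ∀ {a a′ b c d d′ e f g g′ h i} → a ≡ a′ → d ≡ d′ → g ≡ g′ →
                 det3 a b c d e f g h i ≡ det3 a′ b c d′ e f g′ h i
det3-col₁-cong refl refl refl = refl

cramer₁ : ∀ m₁₁ m₁₂ m₁₃ m₂₁ m₂₂ m₂₃ m₃₁ m₃₂ m₃₃ x y z →
  det3 (m₁₁ * x + m₁₂ * y + m₁₃ * z) m₁₂ m₁₃ (m₂₁ * x + m₂₂ * y + m₂₃ * z) m₂₂ m₂₃ (m₃₁ * x + m₃₂ * y + m₃₃ * z) m₃₂ m₃₃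
  ≡ x * det3 m₁₁ m₁₂ m₁₃ m₂₁ m₂₂ m₂₃ m₃₁ m₃₂ m₃₃
cramer₁ = NR.solve 12 (λ m₁₁ m₁₂ m₁₃ m₂₁ m₂₂ m₂₃ m₃₁ m₃₂ m₃₃ x y z →
  Syn.det (m₁₁ ⊛ x ⊕ m₁₂ ⊛ y ⊕ m₁₃ ⊛ z) m₁₂ m₁₃ (m₂₁ ⊛ x ⊕ m₂₂ ⊛ y ⊕ m₂₃ ⊛ z) m₂₂ m₂₃ (m₃₁ ⊛ x ⊕ m₃₂ ⊛ y ⊕ m₃₃ ⊛ z) m₃₂ m₃₃
  ⊜ x ⊛ Syn.det m₁₁ m₁₂ m₁₃ m₂₁ m₂₂ m₂₃ m₃₁ m₃₂ m₃₃) refl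

-- summing the three shift rows over j: the first column of N₁ is D₁'s matrix applied to
-- (X, Σ P_{t_j+1}, Σ P_{t_j-1}), so Cramer's rule solves for X
diagonal-part : ∀ p q n → N₁ p q n ≡ X p q n * D₁ p
diagonal-part p q n = trans (det3-col₁-cong {b = m₁₂} {m₁₃} {e = m₂₂} {m₂₃} {h = m₃₂} {m₃₃} (sym row₀) (sym row₁) (sym row₋₁))
                            (cramer₁ m₁₁ m₁₂ m₁₃ m₂₁ m₂₂ m₂₃ m₃₁ m₃₂ m₃₃ x y z)
  where
  M m₁₁ m₁₂ m₁₃ m₂₁ m₂₂ m₂₃ m₃₁ m₃₂ m₃₃ x y z : ℤ
  M = + 3 * p
  m₁₁ = P (M - + 2) - + 1
  m₁₂ = P (M - + 3)
  m₁₃ = P (M - + 4)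
  m₂₁ = P (M - + 1)
  m₂₂ = P (M - + 2) - + 1
  m₂₃ = P (M - + 3)
  m₃₁ = P (M - + 3)
  m₃₂ = P (M - + 4)
  m₃₃ = P (M - + 5) - + 1
  τ′ : ℕ → ℤ
  τ′ = τ p q n
  x = X p q n
  y = X-shift p q n (+ 1)
  z = X-shift p q n (- + 1)
  sum-rows : ∀ a b c → sumTo n (λ j → a * P (τ′ j) + b * P (τ′ j + + 1) + c * P (τ′ j - + 1)) ≡ a * x + b * y + c * z
  sum-rows a b c = sumTo-lin₃ n a b c (λ j → P (τ′ j)) (λ j → P (τ′ j + + 1)) (λ j → P (τ′ j - + 1))
  row₀ : m₁₁ * x + m₁₂ * y + m₁₃ * z ≡ P (p * + n + + 3 * p + q) - P (q - + 2 * p * + n)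
  row₀ = begin
    m₁₁ * x + m₁₂ * y + m₁₃ * z
      ≡⟨ sym (sum-rows m₁₁ m₁₂ m₁₃) ⟩
    sumTo n (λ j → m₁₁ * P (τ′ j) + m₁₂ * P (τ′ j + + 1) + m₁₃ * P (τ′ j - + 1))
      ≡⟨ sumTo-cong n (λ j → trans (sym (shift-row₀ (τ′ j) M))
                                   (cong₂ (λ u v → P u - P v) (sym (ℤP.+-identityʳ (τ′ j + M))) (sym (ℤP.+-identityʳ (τ′ j))))) ⟩
    sumTo n (λ j → P (τ′ j + M + + 0) - P (τ′ j + + 0))
      ≡⟨ diag-telescope p q n (+ 0) ⟩
    P (p * + n + + 3 * p + q + + 0) - P (q - + 2 * p * + n + + 0)
      ≡⟨ cong₂ (λ u v → P u - P v) (ℤP.+-identityʳ (p * + n + + 3 * p + q)) (ℤP.+-identityʳ (q - + 2 * p * + n)) ⟩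
    P (p * + n + + 3 * p + q) - P (q - + 2 * p * + n) ∎
    where open ≡-Reasoning
  row₁ : m₂₁ * x + m₂₂ * y + m₂₃ * z ≡ P (p * + n + + 3 * p + q + + 1) - P (q - + 2 * p * + n + + 1)
  row₁ = trans (sym (sum-rows m₂₁ m₂₂ m₂₃)) (trans (sumTo-cong n (λ j → sym (shift-row₁ (τ′ j) M))) (diag-telescope p q n (+ 1)))
  row₋₁ : m₃₁ * x + m₃₂ * y + m₃₃ * z ≡ P (p * + n + + 3 * p + q - + 1) - P (q - + 2 * p * + n - + 1)
  row₋₁ = trans (sym (sum-rows m₃₁ m₃₂ m₃₃)) (trans (sumTo-cong n (λ j → sym (shift-row₋₁ (τ′ j) M))) (diag-telescope p q n (- + 1)))

-- The cross part: 2 N₂ = C · D₂.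

W : ℤ → ℤ → ℤ
W a c = P (a + + 1) * P (c - + 4) - P a * P (c - + 3)

W-ω : ∀ a c → W a c ≡ ω (ξ^ a) (ξ^ c)
W-ω a c = cong₂ _-_ (cong₂ _*_ (P-σ· a (+ 1)) (P-σ· c (- + 4))) (cong₂ _*_ (P-σ a) (P-σ· c (- + 3)))

Δ-φ : ∀ a b → Δ a b ≡ φ (ξ^ a) (ξ^ b)
Δ-φ a b = cong₂ _-_ (cong₂ _*_ (P-σ a) (Q-tr b)) (P-σ· a b)

-- ring identities behind W-step and W-reflect (w = ξᵖ has norm 1, v = ξᶜ)
ω-step : ∀ s t w → ω (s · w) (t · (w · w)) - N w * ω s t
                   ≡ - σ (w · ξ⁻³) * φ (s · w) (t · w) + σ (w · ξ⁻⁴) * φ ((s · w) · ξ) (t · w)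
ω-step ⟨ s₀ , s₁ , s₂ ⟩ ⟨ t₀ , t₁ , t₂ ⟩ ⟨ w₀ , w₁ , w₂ ⟩ = NR.solve 9 (λ s₀ s₁ s₂ t₀ t₁ t₂ w₀ w₁ w₂ →
  let s = ⟨ s₀ , s₁ , s₂ ⟩ ; t = ⟨ t₀ , t₁ , t₂ ⟩ ; w = ⟨ w₀ , w₁ , w₂ ⟩ in
  Syn._⊟_ (Syn.ω (Syn._·_ s w) (Syn._·_ t (Syn._·_ w w))) (Syn.N w ⊛ Syn.ω s t)
  ⊜ ((⊝ Syn.σ (Syn._·_ w Syn.ξ⁻³)) ⊛ Syn.φ (Syn._·_ s w) (Syn._·_ t w)
     ⊕ Syn.σ (Syn._·_ w Syn.ξ⁻⁴) ⊛ Syn.φ (Syn._·_ (Syn._·_ s w) Syn.ξ) (Syn._·_ t w)))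
  refl s₀ s₁ s₂ t₀ t₁ t₂ w₀ w₁ w₂

ω-adj : ∀ s v → ω s (adj v) ≡ - ω (s · v) v
ω-adj ⟨ s₀ , s₁ , s₂ ⟩ ⟨ v₀ , v₁ , v₂ ⟩ = NR.solve 6 (λ s₀ s₁ s₂ v₀ v₁ v₂ →
  let s = ⟨ s₀ , s₁ , s₂ ⟩ ; v = ⟨ v₀ , v₁ , v₂ ⟩ in
  Syn.ω s (Syn.adj v) ⊜ (⊝ Syn.ω (Syn._·_ s v) v)) refl s₀ s₁ s₂ v₀ v₁ v₂

ξ^-split : ∀ a p → ξ^ a ≡ ξ^ (a - p) · ξ^ p
ξ^-split a p = trans (cong ξ^_ (regroup a p)) (ξ^-+ (a - p) p)
  where
  regroup : ∀ a p → a ≡ a - p + p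
  regroup = solve-∀

W-step : ∀ a b p → W a (b + p) - W (a - p) (b - p) ≡ - P (p - + 3) * Δ a b + P (p - + 4) * Δ (a + + 1) b
W-step a b p = begin
    W a (b + p) - W (a - p) (b - p)
      ≡⟨ cong₂ _-_ (W-ω a (b + p)) (W-ω (a - p) (b - p)) ⟩
    ω (ξ^ a) (ξ^ (b + p)) - ω s t
      ≡⟨ cong (_- ω s t) (cong₂ ω a-split b+p-split) ⟩
    ω (s · w) (t · (w · w)) - ω s t
      ≡⟨ cong (λ z → ω (s · w) (t · (w · w)) - z) (sym (trans (cong (_* ω s t) (N-ξ^ p)) (ℤP.*-identityˡ (ω s t)))) ⟩
    ω (s · w) (t · (w · w)) - N w * ω s t
      ≡⟨ ω-step s t w ⟩
    - σ (w · ξ⁻³) * φ (s · w) (t · w) + σ (w · ξ⁻⁴) * φ ((s · w) · ξ) (t · w)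
      ≡⟨ sym (cong₂ _+_ (cong₂ _*_ (cong -_ (P-σ· p (- + 3))) Δ₀) (cong₂ _*_ (P-σ· p (- + 4)) Δ₁)) ⟩
    - P (p - + 3) * Δ a b + P (p - + 4) * Δ (a + + 1) b ∎
  where
  open ≡-Reasoning
  s t w : Cubic ℤ
  s = ξ^ (a - p)
  t = ξ^ (b - p)
  w = ξ^ p
  a-split : ξ^ a ≡ s · w
  a-split = ξ^-split a p
  b-split : ξ^ b ≡ t · w
  b-split = ξ^-split b p
  b+p-split : ξ^ (b + p) ≡ t · (w · w)
  b+p-split = trans (cong ξ^_ (regroup b p)) (trans (ξ^-+ (b - p) (p + p)) (cong (t ·_) (ξ^-+ p p)))
    where
    regroup : ∀ b p → b + p ≡ b - p + (p + p)
    regroup = solve-∀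
  Δ₀ : Δ a b ≡ φ (s · w) (t · w)
  Δ₀ = trans (Δ-φ a b) (cong₂ φ a-split b-split)
  Δ₁ : Δ (a + + 1) b ≡ φ ((s · w) · ξ) (t · w)
  Δ₁ = trans (Δ-φ (a + + 1) b) (cong₂ φ (trans (ξ^-+ a (+ 1)) (cong (_· ξ) a-split)) b-split)

-- reflection: W(a - c, -c) = -W(a, c), since ξ⁻ᶜ = adj ξᶜ
W-reflect : ∀ a c → W (a - c) (- c) ≡ - W a c
W-reflect a c = begin
    W (a - c) (- c)        ≡⟨ W-ω (a - c) (- c) ⟩
    ω s (ξ^ (- c))         ≡⟨ cong (ω s) (ξ^-neg c) ⟩
    ω s (adj v)            ≡⟨ ω-adj s v ⟩
    - ω (s · v) v          ≡⟨ cong (λ z → - ω z v) (sym (ξ^-split a c)) ⟩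
    - ω (ξ^ a) v           ≡⟨ cong -_ (sym (W-ω a c)) ⟩
    - W a c                ∎
  where
  open ≡-Reasoning
  s v : Cubic ℤ
  s = ξ^ (a - c)
  v = ξ^ c

Δ-rec : ∀ a b → Δ (a + + 2) b ≡ Δ a b + Δ (a - + 1) b
Δ-rec a b = begin
    P (a + + 2) * Q b - P (a + + 2 + b)
      ≡⟨ cong₂ (λ u v → u * Q b - v)
               (trans (P-rec (a + + 2)) (cong₂ (λ i j → P i + P j) (idx₁ a) (idx₂ a)))
               (trans (P-rec (a + + 2 + b)) (cong₂ (λ i j → P i + P j) (idx₃ a b) (idx₄ a b))) ⟩
    (P a + P (a - + 1)) * Q b - (P (a + b) + P (a - + 1 + b))
      ≡⟨ distribute (P a) (P (a - + 1)) (Q b) (P (a + b)) (P (a - + 1 + b)) ⟩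
    Δ a b + Δ (a - + 1) b ∎
  where
  open ≡-Reasoning
  idx₁ : ∀ a → a + + 2 - + 2 ≡ a
  idx₁ = solve-∀
  idx₂ : ∀ a → a + + 2 - + 3 ≡ a - + 1
  idx₂ = solve-∀
  idx₃ : ∀ a b → a + + 2 + b - + 2 ≡ a + b
  idx₃ = solve-∀
  idx₄ : ∀ a b → a + + 2 + b - + 3 ≡ a - + 1 + b
  idx₄ = solve-∀
  distribute : ∀ x y q u v → (x + y) * q - (u + v) ≡ (x * q - u) + (y * q - v)
  distribute = solve-∀

-- Summing W-step over j telescopes, and reflection identifies the last term:
-- 2 W(q′, pn + p) = -P_{p-3} C(q′) + P_{p-4} C(q′ + 1) for every q′.
cross-row : ∀ p n q′ → W q′ (p * + n + p) + W q′ (p * + n + p) ≡ - P (p - + 3) * C p n q′ + P (p - + 4) * C p n (q′ + + 1)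
cross-row p n q′ = sym (begin
    - A * C p n q′ + B * C p n (q′ + + 1)
      ≡⟨ sym (sumTo-lin₂ n (- A) B (λ j → Δ (a j) (b j)) (λ j → Δ (q′ + + 1 - p * + j) (b j))) ⟩
    sumTo n (λ j → - A * Δ (a j) (b j) + B * Δ (q′ + + 1 - p * + j) (b j))
      ≡⟨ sumTo-cong n step ⟩
    sumTo n (λ j → h j - h (suc j))
      ≡⟨ telescope n h ⟩
    h 0 - h (suc n)
      ≡⟨ cong₂ _-_ (cong₂ W (a₀ q′ p) (b₀ p (+ n))) (trans (cong₂ W (aₙ q′ p (+ n)) (bₙ p (+ n))) (W-reflect q′ (p * + n + p))) ⟩
    W q′ (p * + n + p) - - W q′ (p * + n + p)
      ≡⟨ minus-neg (W q′ (p * + n + p)) ⟩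
    W q′ (p * + n + p) + W q′ (p * + n + p) ∎)
  where
  open ≡-Reasoning
  A B : ℤ
  A = P (p - + 3)
  B = P (p - + 4)
  a b : ℕ → ℤ
  a j = q′ - p * + j
  b j = p * (+ n - + 2 * + j)
  h : ℕ → ℤ
  h j = W (a j) (b j + p)
  a₀ : ∀ q p → q - p * + 0 ≡ q
  a₀ = solve-∀
  b₀ : ∀ p N → p * (N - + 2 * + 0) + p ≡ p * N + p
  b₀ = solve-∀
  aₙ : ∀ q p N → q - p * (+ 1 + N) ≡ q - (p * N + p)
  aₙ = solve-∀
  bₙ : ∀ p N → p * (N - + 2 * (+ 1 + N)) + p ≡ - (p * N + p)
  bₙ = solve-∀
  minus-neg : ∀ k → k - - k ≡ k + k
  minus-neg = solve-∀
  a-shift : ∀ q p J → q + + 1 - p * J ≡ q - p * J + + 1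
  a-shift = solve-∀
  a-next : ∀ q p J → q - p * J - p ≡ q - p * (+ 1 + J)
  a-next = solve-∀
  b-next : ∀ p N J → p * (N - + 2 * J) - p ≡ p * (N - + 2 * (+ 1 + J)) + p
  b-next = solve-∀
  step : ∀ j → - A * Δ (a j) (b j) + B * Δ (q′ + + 1 - p * + j) (b j) ≡ h j - h (suc j)
  step j = trans (cong (λ z → - A * Δ (a j) (b j) + B * Δ z (b j)) (a-shift q′ p (+ j)))
           (trans (sym (W-step (a j) (b j) p))
                  (cong (λ z → h j - z) (cong₂ W (a-next q′ p (+ j)) (b-next p (+ n) (+ j)))))

C-rec : ∀ p n q → C p n (q + + 1 + + 1) ≡ C p n q + C p n (q - + 1)
C-rec p n q = trans (sumTo-cong n step) (sumTo-+ n _ _)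
  where
  b : ℕ → ℤ
  b j = p * (+ n - + 2 * + j)
  idx₂ : ∀ q p J → q + + 1 + + 1 - p * J ≡ q - p * J + + 2
  idx₂ = solve-∀
  idx₋₁ : ∀ q p J → q - p * J - + 1 ≡ q - + 1 - p * J
  idx₋₁ = solve-∀
  step : ∀ j → Δ (q + + 1 + + 1 - p * + j) (b j) ≡ Δ (q - p * + j) (b j) + Δ (q - + 1 - p * + j) (b j)
  step j = trans (cong (λ z → Δ z (b j)) (idx₂ q p (+ j)))
           (trans (Δ-rec (q - p * + j) (b j)) (cong (λ z → Δ (q - p * + j) (b j) + Δ z (b j)) (idx₋₁ q p (+ j))))

cramer₂ : ∀ A B x y z →
  det3 (- A * x + B * y) B (+ 0) (B * x - A * y + B * z) (- A) B (- A * z + B * x) (+ 0) (- A)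
  ≡ x * det3 (- A) B (+ 0) B (- A) B B (+ 0) (- A)
cramer₂ = NR.solve 5 (λ A B x y z →
  Syn.det ((⊝ A) ⊛ x ⊕ B ⊛ y) B (Κ (+ 0)) (Syn._⊟_ (B ⊛ x) (A ⊛ y) ⊕ B ⊛ z) (⊝ A) B ((⊝ A) ⊛ z ⊕ B ⊛ x) (Κ (+ 0)) (⊝ A)
  ⊜ x ⊛ Syn.det (⊝ A) B (Κ (+ 0)) B (⊝ A) B B (Κ (+ 0)) (⊝ A)) refl

det3-double-col₁ : ∀ k₀ k₁ k₂ A B →
  + 2 * det3 k₀ B (+ 0) k₁ (- A) B k₂ (+ 0) (- A) ≡ det3 (k₀ + k₀) B (+ 0) (k₁ + k₁) (- A) B (k₂ + k₂) (+ 0) (- A)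
det3-double-col₁ = NR.solve 5 (λ k₀ k₁ k₂ A B →
  Κ (+ 2) ⊛ Syn.det k₀ B (Κ (+ 0)) k₁ (⊝ A) B k₂ (Κ (+ 0)) (⊝ A)
  ⊜ Syn.det (k₀ ⊕ k₀) B (Κ (+ 0)) (k₁ ⊕ k₁) (⊝ A) B (k₂ ⊕ k₂) (Κ (+ 0)) (⊝ A)) refl

-- cross-row at q′ = q, q + 1, q - 1 (with C-rec) is the cross system; Cramer's rule solves for C
cross-part : ∀ p q n → + 2 * N₂ p q n ≡ C p n q * D₂ p
cross-part p q n = trans (det3-double-col₁ k₀ k₁ k₂ A B)
                   (trans (det3-col₁-cong {b = B} {+ 0} {e = - A} {B} {h = + 0} { - A} row₀ row₁ row₋₁)
                          (cramer₂ A B x y z))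
  where
  m A B x y z k₀ k₁ k₂ : ℤ
  m = p * + n + p
  A = P (p - + 3)
  B = P (p - + 4)
  x = C p n q
  y = C p n (q + + 1)
  z = C p n (q - + 1)
  k₀ = W q m
  k₁ = P (q + + 2) * P (m - + 4) - P (q + + 1) * P (m - + 3)
  k₂ = P q * P (m - + 4) - P (q - + 1) * P (m - + 3)
  succ-succ : ∀ q → q + + 1 + + 1 ≡ q + + 2
  succ-succ = solve-∀
  W₁ : W (q + + 1) m ≡ k₁
  W₁ = cong (λ u → P u * P (m - + 4) - P (q + + 1) * P (m - + 3)) (succ-succ q)
  W₋₁ : W (q - + 1) m ≡ k₂
  W₋₁ = cong (λ u → P u * P (m - + 4) - P (q - + 1) * P (m - + 3)) (pred-suc q)
  regroup : ∀ A B x y z → - A * y + B * (x + z) ≡ B * x - A * y + B * z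
  regroup = solve-∀
  row₀ : k₀ + k₀ ≡ - A * x + B * y
  row₀ = cross-row p n q
  row₁ : k₁ + k₁ ≡ B * x - A * y + B * z
  row₁ = trans (cong₂ _+_ (sym W₁) (sym W₁))
         (trans (cross-row p n (q + + 1)) (trans (cong (λ u → - A * y + B * u) (C-rec p n q)) (regroup A B x y z)))
  row₋₁ : k₂ + k₂ ≡ - A * z + B * x
  row₋₁ = trans (cong₂ _+_ (sym W₋₁) (sym W₋₁))
          (trans (cross-row p n (q - + 1)) (cong (λ u → - A * z + B * C p n u) (pred-suc q)))

-- The denominators do not vanish.

-- congruence of integers modulo m (a record, so that a, b, m are recovered by unification),
-- and its compatibility with the ring operations
infix 4 _≋_mod_ _≋ᶜ_mod_

record _≋_mod_ (a b m : ℤ) : Set where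
  constructor divides-difference
  field difference : m ∣ a - b
open _≋_mod_

≋-refl : ∀ {m} a → a ≋ a mod m
≋-refl {m} a = divides-difference (divides (+ 0) (trans (ℤP.+-inverseʳ a) (sym (ℤP.*-zeroˡ m))))

≋-+ : ∀ {m a b c d} → a ≋ b mod m → c ≋ d mod m → a + c ≋ b + d mod m
≋-+ {m} {a} {b} {c} {d} a≋b c≋d =
  divides-difference (subst (m ∣_) (regroup a b c d) (∣m∣n⇒∣m+n (difference a≋b) (difference c≋d)))
  where
  regroup : ∀ a b c d → (a - b) + (c - d) ≡ (a + c) - (b + d)
  regroup = solve-∀

≋-neg : ∀ {m a b} → a ≋ b mod m → - a ≋ - b mod m
≋-neg {m} {a} {b} a≋b = divides-difference (subst (m ∣_) (regroup a b) (∣m⇒∣-m (difference a≋b)))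
  where
  regroup : ∀ a b → - (a - b) ≡ - a - - b
  regroup = solve-∀

≋-- : ∀ {m a b c d} → a ≋ b mod m → c ≋ d mod m → a - c ≋ b - d mod m
≋-- a≋b c≋d = ≋-+ a≋b (≋-neg c≋d)

≋-* : ∀ {m a b c d} → a ≋ b mod m → c ≋ d mod m → a * c ≋ b * d mod m
≋-* {m} {a} {b} {c} {d} a≋b c≋d =
  divides-difference (subst (m ∣_) (regroup a b c d) (∣m∣n⇒∣m+n (∣n⇒∣m*n a (difference c≋d)) (∣m⇒∣m*n d (difference a≋b))))
  where
  regroup : ∀ a b c d → a * (c - d) + (a - b) * d ≡ a * c - b * d
  regroup = solve-∀

_≋ᶜ_mod_ : Cubic ℤ → Cubic ℤ → ℤ → Set
u ≋ᶜ v mod m = (c₀ u ≋ c₀ v mod m) × (c₁ u ≋ c₁ v mod m) × (c₂ u ≋ c₂ v mod m)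

≋ᶜ-refl : ∀ {m} u → u ≋ᶜ u mod m
≋ᶜ-refl u = ≋-refl (c₀ u) , ≋-refl (c₁ u) , ≋-refl (c₂ u)

·-≋ᶜ : ∀ {m} u v w w′ → u ≋ᶜ v mod m → w ≋ᶜ w′ mod m → u · w ≋ᶜ v · w′ mod m
·-≋ᶜ ⟨ _ , _ , _ ⟩ ⟨ _ , _ , _ ⟩ ⟨ _ , _ , _ ⟩ ⟨ _ , _ , _ ⟩ (e₀ , e₁ , e₂) (f₀ , f₁ , f₂) =
    ≋-+ (≋-* e₀ f₀) (≋-+ (≋-* e₁ f₂) (≋-* e₂ f₁))
  , ≋-+ (≋-+ (≋-+ (≋-* e₀ f₁) (≋-* e₁ f₀)) (≋-+ (≋-* e₁ f₂) (≋-* e₂ f₁))) (≋-* e₂ f₂)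
  , ≋-+ (≋-+ (≋-+ (≋-* e₀ f₂) (≋-* e₁ f₁)) (≋-* e₂ f₀)) (≋-* e₂ f₂)

det-≋ : ∀ {m a b c d e f g h i a′ b′ c′ d′ e′ f′ g′ h′ i′} →
         a ≋ a′ mod m → b ≋ b′ mod m → c ≋ c′ mod m → d ≋ d′ mod m → e ≋ e′ mod m →
         f ≋ f′ mod m → g ≋ g′ mod m → h ≋ h′ mod m → i ≋ i′ mod m →
         det a b c d e f g h i ≋ det a′ b′ c′ d′ e′ f′ g′ h′ i′ mod m
det-≋ ea eb ec ed ee ef eg eh ei =
  ≋-+ (≋-- (≋-* ea (≋-- (≋-* ee ei) (≋-* ef eh))) (≋-* eb (≋-- (≋-* ed ei) (≋-* ef eg))))
      (≋-* ec (≋-- (≋-* ed eh) (≋-* ee eg)))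

N-≋ : ∀ {m} u v → u ≋ᶜ v mod m → N u ≋ N v mod m
N-≋ {m} u v u≋v@(e₀ , e₁ , e₂) =
  det-≋ e₀ (proj₁ eξ) (proj₁ eξ²) e₁ (proj₁ (proj₂ eξ)) (proj₁ (proj₂ eξ²)) e₂ (proj₂ (proj₂ eξ)) (proj₂ (proj₂ eξ²))
  where
  eξ : u · ξ ≋ᶜ v · ξ mod m
  eξ = ·-≋ᶜ u v ξ ξ u≋v (≋ᶜ-refl ξ)
  eξ² : u · ξ² ≋ᶜ v · ξ² mod m
  eξ² = ·-≋ᶜ u v ξ² ξ² u≋v (≋ᶜ-refl ξ²)

residue-≋ : ∀ z → z ≋ + (z %ℕ 2) mod + 2
residue-≋ z = divides-difference (divides (z /ℕ 2) (sym (subtract (a≡a%ℕn+[a/ℕn]*n z 2))))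

not-even : ∀ {z} → False (2 ∣ℕ? ∣ z ∣) → ¬ (+ 2 ∣ z)
not-even odd 2∣z = toWitnessFalse odd (∣⇒∣ᵤ 2∣z)

-- every nonzero vector of residues has odd norm (t³ - t - 1 is irreducible over 𝔽₂)
residue-norm-odd : ∀ {a b c} → a ℕ.< 2 → b ℕ.< 2 → c ℕ.< 2 → + 2 ∣ N ⟨ + a , + b , + c ⟩ → a ≡ 0 × b ≡ 0 × c ≡ 0
residue-norm-odd (s≤s z≤n)       (s≤s z≤n)       (s≤s z≤n)       _ = refl , refl , refl
residue-norm-odd (s≤s z≤n)       (s≤s z≤n)       (s≤s (s≤s z≤n)) d = ⊥-elim (not-even _ d)
residue-norm-odd (s≤s z≤n)       (s≤s (s≤s z≤n)) (s≤s z≤n)       d = ⊥-elim (not-even _ d)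
residue-norm-odd (s≤s z≤n)       (s≤s (s≤s z≤n)) (s≤s (s≤s z≤n)) d = ⊥-elim (not-even _ d)
residue-norm-odd (s≤s (s≤s z≤n)) (s≤s z≤n)       (s≤s z≤n)       d = ⊥-elim (not-even _ d)
residue-norm-odd (s≤s (s≤s z≤n)) (s≤s z≤n)       (s≤s (s≤s z≤n)) d = ⊥-elim (not-even _ d)
residue-norm-odd (s≤s (s≤s z≤n)) (s≤s (s≤s z≤n)) (s≤s z≤n)       d = ⊥-elim (not-even _ d)
residue-norm-odd (s≤s (s≤s z≤n)) (s≤s (s≤s z≤n)) (s≤s (s≤s z≤n)) d = ⊥-elim (not-even _ d)

double halve : Cubic ℤ → Cubic ℤ
double ⟨ a , b , c ⟩ = ⟨ a * + 2 , b * + 2 , c * + 2 ⟩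
halve ⟨ a , b , c ⟩ = ⟨ a /ℕ 2 , b /ℕ 2 , c /ℕ 2 ⟩

even-coordinate : ∀ z → z %ℕ 2 ≡ 0 → z ≡ (z /ℕ 2) * + 2
even-coordinate z r≡0 = trans (a≡a%ℕn+[a/ℕn]*n z 2) (trans (cong (λ r → + r + (z /ℕ 2) * + 2) r≡0) (ℤP.+-identityˡ _))

residues-even-norm : ∀ a b c → + 2 ∣ N ⟨ a , b , c ⟩ → + 2 ∣ N ⟨ + (a %ℕ 2) , + (b %ℕ 2) , + (c %ℕ 2) ⟩
residues-even-norm a b c 2∣Nu = subst (+ 2 ∣_) (cancel (N u) (N r)) (∣m∣n⇒∣m-n 2∣Nu (difference (N-≋ u r u≋r)))
  where
  u r : Cubic ℤ
  u = ⟨ a , b , c ⟩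
  r = ⟨ + (a %ℕ 2) , + (b %ℕ 2) , + (c %ℕ 2) ⟩
  u≋r : u ≋ᶜ r mod + 2
  u≋r = residue-≋ a , residue-≋ b , residue-≋ c
  cancel : ∀ x y → x - (x - y) ≡ y
  cancel = solve-∀

even-norm⇒double : ∀ u → + 2 ∣ N u → u ≡ double (halve u)
even-norm⇒double ⟨ a , b , c ⟩ 2∣Nu =
  cubic-≡ (even-coordinate a (proj₁ even)) (even-coordinate b (proj₁ (proj₂ even))) (even-coordinate c (proj₂ (proj₂ even)))
  where
  even : a %ℕ 2 ≡ 0 × b %ℕ 2 ≡ 0 × c %ℕ 2 ≡ 0
  even = residue-norm-odd (n%ℕd<d a 2) (n%ℕd<d b 2) (n%ℕd<d c 2) (residues-even-norm a b c 2∣Nu)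

N-double : ∀ h → N (double h) ≡ + 8 * N h
N-double ⟨ a , b , c ⟩ = NR.solve 3 (λ a b c →
  Syn.N ⟨ a ⊛ Κ (+ 2) , b ⊛ Κ (+ 2) , c ⊛ Κ (+ 2) ⟩ ⊜ Κ (+ 8) ⊛ Syn.N ⟨ a , b , c ⟩) refl a b c

cancel-factor : ∀ {c x} → c ≢ + 0 → c * x ≡ + 0 → x ≡ + 0
cancel-factor {c} c≢0 cx≡0 with ℤP.i*j≡0⇒i≡0∨j≡0 c cx≡0
... | inj₁ c≡0 = ⊥-elim (c≢0 c≡0)
... | inj₂ x≡0 = x≡0

-- the measure of the descent
size : Cubic ℤ → ℕ
size ⟨ a , b , c ⟩ = ∣ a ∣ ℕ.+ ∣ b ∣ ℕ.+ ∣ c ∣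

size-double : ∀ h → size (double h) ≡ size h ℕ.* 2
size-double ⟨ a , b , c ⟩ = trans (cong₂ ℕ._+_ (cong₂ ℕ._+_ (ℤP.abs-* a (+ 2)) (ℤP.abs-* b (+ 2))) (ℤP.abs-* c (+ 2)))
                                  (distrib (∣ a ∣) (∣ b ∣) (∣ c ∣))
  where
  distrib : ∀ x y z → x ℕ.* 2 ℕ.+ y ℕ.* 2 ℕ.+ z ℕ.* 2 ≡ (x ℕ.+ y ℕ.+ z) ℕ.* 2
  distrib = ℕ-solve-∀

0ᶜ : Cubic ℤ
0ᶜ = ⟨ + 0 , + 0 , + 0 ⟩

size-zero : ∀ u → size u ≡ 0 → u ≡ 0ᶜ
size-zero ⟨ a , b , c ⟩ size≡0 =
  cubic-≡ (ℤP.∣i∣≡0⇒i≡0 (ℕP.m+n≡0⇒m≡0 (∣ a ∣) ab≡0)) (ℤP.∣i∣≡0⇒i≡0 (ℕP.m+n≡0⇒n≡0 (∣ a ∣) ab≡0))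
          (ℤP.∣i∣≡0⇒i≡0 (ℕP.m+n≡0⇒n≡0 (∣ a ∣ ℕ.+ ∣ b ∣) size≡0))
  where
  ab≡0 : ∣ a ∣ ℕ.+ ∣ b ∣ ≡ 0
  ab≡0 = ℕP.m+n≡0⇒m≡0 (∣ a ∣ ℕ.+ ∣ b ∣) size≡0

half-bound : ∀ m f → m ℕ.* 2 ℕ.≤ suc f → m ℕ.≤ f
half-bound zero    f _         = z≤n
half-bound (suc m) f (s≤s le) = ℕP.≤-trans (s≤s (ℕP.m≤m*n m 2)) le

-- Descent: if N u = 0 then u = 2h with N h = 0 and h smaller, unless u = 0.
anisotropic-below : ∀ f u → size u ℕ.≤ f → N u ≡ + 0 → u ≡ 0ᶜ
anisotropic-below zero    u small _    = size-zero u (ℕP.n≤0⇒n≡0 small)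
anisotropic-below (suc f) u small Nu≡0 =
  trans u≡2h (cong double (anisotropic-below f h (half-bound (size h) f h-small) Nh≡0))
  where
  h : Cubic ℤ
  h = halve u
  u≡2h : u ≡ double h
  u≡2h = even-norm⇒double u (subst (+ 2 ∣_) (sym Nu≡0) (divides (+ 0) refl))
  h-small : size h ℕ.* 2 ℕ.≤ suc f
  h-small = subst (ℕ._≤ suc f) (trans (cong size u≡2h) (size-double h)) small
  Nh≡0 : N h ≡ + 0
  Nh≡0 = cancel-factor {+ 8} (λ ()) (trans (sym (N-double h)) (trans (cong N (sym u≡2h)) Nu≡0))

N-anisotropic : ∀ u → N u ≡ + 0 → u ≡ 0ᶜ
N-anisotropic u = anisotropic-below (size u) u ℕP.≤-refl

padovanℕ-pos : ∀ m → Σ ℕ λ c → padovanℕ m ≡ + suc c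
padovanℕ-pos 0 = 0 , refl
padovanℕ-pos 1 = 0 , refl
padovanℕ-pos 2 = 0 , refl
padovanℕ-pos (suc (suc (suc m))) with padovanℕ-pos (suc m) | padovanℕ-pos m
... | a , ea | b , eb = a ℕ.+ suc b , cong₂ _+_ ea eb

ξ^-scalar-ℕ : ∀ n → P (+ n - + 3) ≡ + 0 → P (+ n - + 4) ≡ + 0 → + n ≡ + 0
ξ^-scalar-ℕ 0 _ _ = refl
ξ^-scalar-ℕ 1 () _
ξ^-scalar-ℕ 2 _ ()
ξ^-scalar-ℕ 3 () _
ξ^-scalar-ℕ (suc (suc (suc (suc m)))) _ e with padovanℕ-pos m
... | c , pos with () ← trans (sym pos) e

-- ξᵏ is an integer only for k = 0: for k < 0, ξᵏ = c gives 1 = c ξ⁻ᵏ, so ξ⁻ᵏ would be an integer too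
ξ^-scalar⇒0 : ∀ k → P (k - + 3) ≡ + 0 → P (k - + 4) ≡ + 0 → k ≡ + 0
ξ^-scalar⇒0 (+ n) = ξ^-scalar-ℕ n
ξ^-scalar⇒0 k@(-[1+ m ]) e₃ e₄ = ⊥-elim (nonzero (ξ^-scalar-ℕ (suc m) (cancel (cong c₁ one≡cu)) (cancel (cong c₂ one≡cu))))
  where
  c : ℤ
  c = P (k - + 5)
  u : Cubic ℤ
  u = ξ^ (- k)
  ξ^k-scalar : ξ^ k ≡ scalar c
  ξ^k-scalar = cubic-≡ refl e₃ e₄
  one≡cu : 𝟙 ≡ ⟨ c * c₀ u , c * c₁ u , c * c₂ u ⟩
  one≡cu = begin
    𝟙                  ≡⟨ cong ξ^_ (sym (ℤP.+-inverseʳ k)) ⟩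
    ξ^ (k + - k)       ≡⟨ ξ^-+ k (- k) ⟩
    ξ^ k · u           ≡⟨ cong (_· u) ξ^k-scalar ⟩
    scalar c · u       ≡⟨ scalar-· c u ⟩
    ⟨ c * c₀ u , c * c₁ u , c * c₂ u ⟩ ∎
    where open ≡-Reasoning
  nonzero : ∀ {n} → + suc n ≢ + 0
  nonzero ()
  c≢0 : c ≢ + 0
  c≢0 c≡0 = nonzero (trans (cong c₀ one≡cu) (trans (cong (_* c₀ u) c≡0) (ℤP.*-zeroˡ (c₀ u))))
  cancel : ∀ {v} → + 0 ≡ c * v → v ≡ + 0
  cancel 0≡cv = cancel-factor c≢0 (sym 0≡cv)

-- D₁ is the norm of ξ^{3p} - 1
D₁-norm : ∀ p → D₁ p ≡ N ⟨ P (+ 3 * p - + 5) - + 1 , P (+ 3 * p - + 3) , P (+ 3 * p - + 4) ⟩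
D₁-norm p = trans (cong₂ (λ a b → det3 (a - + 1) w₁ w₂ b (a - + 1) w₁ w₁ w₂ (w₀ - + 1)) (P-rec₂ M) P-M-1)
                  (as-norm w₀ w₁ w₂)
  where
  M w₀ w₁ w₂ : ℤ
  M = + 3 * p
  w₀ = P (M - + 5)
  w₁ = P (M - + 3)
  w₂ = P (M - + 4)
  idx₃ : ∀ M → M - + 1 - + 2 ≡ M - + 3
  idx₃ = solve-∀
  idx₄ : ∀ M → M - + 1 - + 3 ≡ M - + 4
  idx₄ = solve-∀
  P-M-1 : P (M - + 1) ≡ w₁ + w₂
  P-M-1 = trans (P-rec (M - + 1)) (cong₂ (λ i j → P i + P j) (idx₃ M) (idx₄ M))
  as-norm : ∀ w₀ w₁ w₂ → det3 (w₂ + w₀ - + 1) w₁ w₂ (w₁ + w₂) (w₂ + w₀ - + 1) w₁ w₁ w₂ (w₀ - + 1) ≡ N ⟨ w₀ - + 1 , w₁ , w₂ ⟩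
  as-norm = NR.solve 3 (λ w₀ w₁ w₂ →
    Syn.det (Syn._⊟_ (w₂ ⊕ w₀) (Κ (+ 1))) w₁ w₂ (w₁ ⊕ w₂) (Syn._⊟_ (w₂ ⊕ w₀) (Κ (+ 1))) w₁ w₁ w₂ (Syn._⊟_ w₀ (Κ (+ 1)))
    ⊜ Syn.N ⟨ Syn._⊟_ w₀ (Κ (+ 1)) , w₁ , w₂ ⟩) refl

D₁≢0 : ∀ p → p ≢ + 0 → D₁ p ≢ + 0
D₁≢0 p p≢0 D₁≡0 = p≢0 (cancel-factor {+ 3} (λ ()) (ξ^-scalar⇒0 (+ 3 * p) (cong c₁ vanishes) (cong c₂ vanishes)))
  where
  vanishes : ⟨ P (+ 3 * p - + 5) - + 1 , P (+ 3 * p - + 3) , P (+ 3 * p - + 4) ⟩ ≡ 0ᶜ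
  vanishes = N-anisotropic _ (trans (sym (D₁-norm p)) D₁≡0)

D₂-norm : ∀ A B → det3 (- A) B (+ 0) B (- A) B B (+ 0) (- A) ≡ - N ⟨ A , - B , + 0 ⟩
D₂-norm = NR.solve 2 (λ A B →
  Syn.det (⊝ A) B (Κ (+ 0)) B (⊝ A) B B (Κ (+ 0)) (⊝ A) ⊜ (⊝ Syn.N ⟨ A , ⊝ B , Κ (+ 0) ⟩)) refl

D₂≢0 : ∀ p → p ≢ + 0 → D₂ p ≢ + 0
D₂≢0 p p≢0 D₂≡0 = p≢0 (ξ^-scalar⇒0 p (cong c₀ vanishes) (neg≡0 (cong c₁ vanishes)))
  where
  neg≡0 : ∀ {x} → - x ≡ + 0 → x ≡ + 0
  neg≡0 {x} -x≡0 = trans (sym (ℤP.neg-involutive x)) (cong -_ -x≡0)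
  vanishes : ⟨ P (p - + 3) , - P (p - + 4) , + 0 ⟩ ≡ 0ᶜ
  vanishes = N-anisotropic _ (neg≡0 (trans (sym (D₂-norm (P (p - + 3)) (P (p - + 4)))) D₂≡0))

main-identity : ∀ p q n → S p q n * D₁ p * D₂ p ≡ N₁ p q n * D₂ p + + 2 * N₂ p q n * D₁ p
main-identity p q n = begin
    S p q n * D₁ p * D₂ p                        ≡⟨ cong (λ s → s * D₁ p * D₂ p) (S-split p q n) ⟩
    (X p q n + C p n q) * D₁ p * D₂ p            ≡⟨ regroup (X p q n) (C p n q) (D₁ p) (D₂ p) ⟩
    X p q n * D₁ p * D₂ p + C p n q * D₂ p * D₁ p ≡⟨ cong₂ _+_ (cong (_* D₂ p) (sym (diagonal-part p q n)))
                                                              (cong (_* D₁ p) (sym (cross-part p q n))) ⟩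
    N₁ p q n * D₂ p + + 2 * N₂ p q n * D₁ p ∎
  where
  open ≡-Reasoning
  regroup : ∀ x c d₁ d₂ → (x + c) * d₁ * d₂ ≡ x * d₁ * d₂ + c * d₂ * d₁
  regroup = solve-∀

unit-denominators : ∀ {s a b} → s * + 1 * - + 1 ≡ a * - + 1 + + 2 * b * + 1 → s ≡ a - + 2 * b
unit-denominators {s} {a} {b} eq = trans (negate s) (trans (cong -_ eq) (simplify a b))
  where
  negate : ∀ s → s ≡ - (s * + 1 * - + 1)
  negate = solve-∀
  simplify : ∀ a b → - (a * - + 1 + + 2 * b * + 1) ≡ a - + 2 * b
  simplify = solve-∀

det3-last-entry : ∀ a b c → det3 a (+ 1) (+ 0) b (+ 0) (+ 1) c (+ 0) (+ 0) ≡ c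
det3-last-entry = NR.solve 3 (λ a b c → Syn.det a (Κ (+ 1)) (Κ (+ 0)) b (Κ (+ 0)) (Κ (+ 1)) c (Κ (+ 0)) (Κ (+ 0)) ⊜ c) refl

det3-first-entry : ∀ a b c → det3 a (+ 0) (+ 0) b (- + 1) (+ 0) c (+ 0) (- + 1) ≡ a
det3-first-entry = NR.solve 3 (λ a b c → Syn.det a (Κ (+ 0)) (Κ (+ 0)) b (⊝ Κ (+ 1)) (Κ (+ 0)) c (Κ (+ 0)) (⊝ Κ (+ 1)) ⊜ a) refl

-- For p = 1 the denominators are D₁ = 1 and D₂ = -1 and the numerators collapse to single entries.
special-case : ∀ q n → sumTo n (λ j → P (q - + j) * Q (+ n - + 2 * + j))
                       ≡ P (+ n + q + + 2) - P (q - + 2 * + n - + 1) - + 2 * (P (q + + 1) * P (+ n - + 3) - P q * P (+ n - + 2))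
special-case q n = begin
    sumTo n (λ j → P (q - + j) * Q (+ n - + 2 * + j))
      ≡⟨ sumTo-cong n (λ j → cong₂ (λ a b → P (q - a) * Q b) (sym (ℤP.*-identityˡ (+ j))) (sym (ℤP.*-identityˡ (+ n - + 2 * + j)))) ⟩
    S (+ 1) q n
      ≡⟨ unit-denominators {S (+ 1) q n} {N₁ (+ 1) q n} {N₂ (+ 1) q n} (main-identity (+ 1) q n) ⟩
    N₁ (+ 1) q n - + 2 * N₂ (+ 1) q n
      ≡⟨ cong₂ (λ a b → a - + 2 * b) N₁-at-1 N₂-at-1 ⟩
    P (+ n + q + + 2) - P (q - + 2 * + n - + 1) - + 2 * (P (q + + 1) * P (+ n - + 3) - P q * P (+ n - + 2)) ∎
  where
  open ≡-Reasoning
  m : ℤ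
  m = + 1 * + n + + 1
  idx₁ : ∀ N q → + 1 * N + + 3 * + 1 + q - + 1 ≡ N + q + + 2
  idx₁ = solve-∀
  idx₂ : ∀ N q → q - + 2 * + 1 * N - + 1 ≡ q - + 2 * N - + 1
  idx₂ = solve-∀
  idx₃ : ∀ N → + 1 * N + + 1 - + 4 ≡ N - + 3
  idx₃ = solve-∀
  idx₄ : ∀ N → + 1 * N + + 1 - + 3 ≡ N - + 2
  idx₄ = solve-∀
  N₁-at-1 : N₁ (+ 1) q n ≡ P (+ n + q + + 2) - P (q - + 2 * + n - + 1)
  N₁-at-1 = trans (det3-last-entry (P (+ 1 * + n + + 3 * + 1 + q) - P (q - + 2 * + 1 * + n))
                                   (P (+ 1 * + n + + 3 * + 1 + q + + 1) - P (q - + 2 * + 1 * + n + + 1))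
                                   (P (+ 1 * + n + + 3 * + 1 + q - + 1) - P (q - + 2 * + 1 * + n - + 1)))
                  (cong₂ (λ i j → P i - P j) (idx₁ (+ n) q) (idx₂ (+ n) q))
  N₂-at-1 : N₂ (+ 1) q n ≡ P (q + + 1) * P (+ n - + 3) - P q * P (+ n - + 2)
  N₂-at-1 = trans (det3-first-entry (P (q + + 1) * P (m - + 4) - P q * P (m - + 3))
                                    (P (q + + 2) * P (m - + 4) - P (q + + 1) * P (m - + 3))
                                    (P q * P (m - + 4) - P (q - + 1) * P (m - + 3)))
                  (cong₂ (λ i j → P (q + + 1) * P i - P q * P j) (idx₃ (+ n)) (idx₄ (+ n)))

theorem13 : (p q : ℤ) (n : ℕ) → p ≢ + 0 →
  (det3 (P (+ 3 * p - + 2) - + 1) (P (+ 3 * p - + 3)) (P (+ 3 * p - + 4))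
        (P (+ 3 * p - + 1)) (P (+ 3 * p - + 2) - + 1) (P (+ 3 * p - + 3))
        (P (+ 3 * p - + 3)) (P (+ 3 * p - + 4)) (P (+ 3 * p - + 5) - + 1) ≢ + 0)
  × (det3 (- P (p - + 3)) (P (p - + 4)) (+ 0)
          (P (p - + 4)) (- P (p - + 3)) (P (p - + 4))
          (P (p - + 4)) (+ 0) (- P (p - + 3)) ≢ + 0)
  × (sumTo n (λ j → P (q - p * + j) * Q (p * (+ n - + 2 * + j)))
      * det3 (P (+ 3 * p - + 2) - + 1) (P (+ 3 * p - + 3)) (P (+ 3 * p - + 4))
             (P (+ 3 * p - + 1)) (P (+ 3 * p - + 2) - + 1) (P (+ 3 * p - + 3))
             (P (+ 3 * p - + 3)) (P (+ 3 * p - + 4)) (P (+ 3 * p - + 5) - + 1)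
      * det3 (- P (p - + 3)) (P (p - + 4)) (+ 0)
             (P (p - + 4)) (- P (p - + 3)) (P (p - + 4))
             (P (p - + 4)) (+ 0) (- P (p - + 3))
    ≡ det3 (P (p * + n + + 3 * p + q) - P (q - + 2 * p * + n)) (P (+ 3 * p - + 3)) (P (+ 3 * p - + 4))
           (P (p * + n + + 3 * p + q + + 1) - P (q - + 2 * p * + n + + 1)) (P (+ 3 * p - + 2) - + 1) (P (+ 3 * p - + 3))
           (P (p * + n + + 3 * p + q - + 1) - P (q - + 2 * p * + n - + 1)) (P (+ 3 * p - + 4)) (P (+ 3 * p - + 5) - + 1)
      * det3 (- P (p - + 3)) (P (p - + 4)) (+ 0)
             (P (p - + 4)) (- P (p - + 3)) (P (p - + 4))
             (P (p - + 4)) (+ 0) (- P (p - + 3))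
      + + 2 * det3 (P (q + + 1) * P (p * + n + p - + 4) - P q * P (p * + n + p - + 3)) (P (p - + 4)) (+ 0)
                   (P (q + + 2) * P (p * + n + p - + 4) - P (q + + 1) * P (p * + n + p - + 3)) (- P (p - + 3)) (P (p - + 4))
                   (P q * P (p * + n + p - + 4) - P (q - + 1) * P (p * + n + p - + 3)) (+ 0) (- P (p - + 3))
      * det3 (P (+ 3 * p - + 2) - + 1) (P (+ 3 * p - + 3)) (P (+ 3 * p - + 4))
             (P (+ 3 * p - + 1)) (P (+ 3 * p - + 2) - + 1) (P (+ 3 * p - + 3))
             (P (+ 3 * p - + 3)) (P (+ 3 * p - + 4)) (P (+ 3 * p - + 5) - + 1))
  × (sumTo n (λ j → P (q - + j) * Q (+ n - + 2 * + j))
    ≡ P (+ n + q + + 2) - P (q - + 2 * + n - + 1)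
      - + 2 * (P (q + + 1) * P (+ n - + 3) - P q * P (+ n - + 2)))
theorem13 p q n p≢0 = D₁≢0 p p≢0 , D₂≢0 p p≢0 , main-identity p q n , special-case q n
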